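{- For every integer $k \ge 0$ define $a_k(n)$ by $\sum_{n\ge 0} a_k(n) q^n = \dfrac{f_2^{k-1}}{f_1^{k}}$, where $f_\ell = \prod_{m\ge 1}(1-q^{\ell m})$. Then for all $r \ge 0$ and all $n \ge 0$, $$a_{2r}(2n+1) \equiv 0 \pmod{2}.$$
   Context: For $k\ge 1$, $a_k(n)$ counts the partitions of $n$ in which even parts come in only one color while odd parts may appear in one of $k$ colors; its generating function is $\sum_{n\ge0}a_k(n)q^n = f_2^{k-1}/f_1^k$ with $f_\ell:=(q^\ell;q^\ell)_\infty=\prod_{m\ge1}(1-q^{\ell m})$, $|q|<1$. -}

module Defs where

open import Data.Nat as ℕ using (ℕ; zero; suc; _≤ᵇ_)
open import Data.Integer as ℤ using (ℤ; +_; -_; _+_; _*_)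
open import Data.Bool using (if_then_else_)
open import Data.List using (List; map; upTo)
open import Data.List as L using ()

-- Formal power series in q with integer coefficients: n ↦ coefficient of q^n.
Series : Set
Series = ℕ → ℤ

sumℤ : List ℤ → ℤ
sumℤ = L.foldr _+_ (+ 0)

one : Series
one zero    = + 1
one (suc _) = + 0

_⊛_ : Series → Series → Series
(a ⊛ b) n = sumℤ (map (λ i → a i * b (n ℕ.∸ i)) (upTo (suc n)))

infixl 7 _⊛_

pow : Series → ℕ → Series
pow s zero    = one
pow s (suc k) = s ⊛ pow s k

oneMinusQ^ : ℕ → Series
oneMinusQ^ d n = if (n ℕ.≡ᵇ 0) then + 1 else (if (n ℕ.≡ᵇ d) then - (+ 1) else + 0)

partialProd : ℕ → ℕ → Series
partialProd ℓ zero    = one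
partialProd ℓ (suc N) = partialProd ℓ N ⊛ oneMinusQ^ (ℓ ℕ.* suc N)

-- f_ℓ = ∏_{m≥1} (1 - q^{ℓ m}); for ℓ ≥ 1 the coefficient of q^n only depends
-- on the factors with m ≤ n, so it is the coefficient of the n-th partial product.
f : ℕ → Series
f ℓ n = partialProd ℓ n n

-- Multiplicative inverse of a series s with constant term 1:
-- b(0) = 1,  b(n) = - Σ_{i=1}^{n} s(i) b(n-i).
-- invUpTo s N is correct on all indices ≤ N.
invUpTo : Series → ℕ → Series
invUpTo s zero    = λ _ → + 1
invUpTo s (suc N) = λ j →
  if j ≤ᵇ N then prev j
  else - sumℤ (map (λ i → s (suc i) * prev (N ℕ.∸ i)) (upTo (suc N)))
  where
  prev : Series
  prev = invUpTo s N

inv : Series → Series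
inv s n = invUpTo s n n

-- Generating function of a_k:  f_2^{k-1} / f_1^k  =  f_2^k · f_2^{-1} · (f_1^{-1})^k
-- (valid for every k ≥ 0, including k = 0 where it is 1/f_2).
a : ℕ → ℕ → ℤ
a k = pow (f 2) k ⊛ inv (f 2) ⊛ pow (inv (f 1)) k

-- Work with series whose odd-indexed coefficients are all even.  They are
-- closed under products and under inversion: for odd m, each term of
-- Σ s(i) b(m - i) has i or m - i odd.  Every square s² is such a series, as
-- its coefficient of q^m, m odd, is a sum of pairs s(i) s(m - i) + s(m - i) s(i);
-- and so is f₂, a series in q².  Hence so is
--   f₂^{2r-1} / f₁^{2r} = f₂^{2r} · f₂^{-1} · (f₁^{-1})^{2r}.
module Submission where

open import Defs
open import Data.Nat using (ℕ; suc; _*_)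
open import Data.Integer using (+_)
open import Data.Integer.Divisibility using (_∣_)

open import Data.Nat as ℕ using (zero; _+_; _∸_; _≤_; _<_; _≤ᵇ_; z≤n; s≤s)
import Data.Nat.Properties as ℕ
import Data.Nat.Divisibility as ℕ
open import Data.Integer as ℤ using (ℤ) renaming (_+_ to _+ᶻ_; _*_ to _*ᶻ_)
import Data.Integer.Properties as ℤ
import Data.Integer.Divisibility.Signed as ℤ
open import Data.Integer.Tactic.RingSolver using (solve-∀)
open import Data.Bool using (true; false; T)
open import Data.Unit using (tt)
open import Data.List using (applyUpTo; map; upTo)
import Data.List.Properties as List
open import Data.Empty using (⊥-elim)
open import Data.Sum using (_⊎_; inj₁; inj₂)
open import Function using (_∘_)
open import Relation.Nullary using (¬_; yes; no)
open import Relation.Binary.PropositionalEquality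
open ≡-Reasoning

sumBelow : ℕ → (ℕ → ℤ) → ℤ
sumBelow n F = sumℤ (applyUpTo F n)

sumℤ-map-upTo : ∀ n (F : ℕ → ℤ) → sumℤ (map F (upTo n)) ≡ sumBelow n F
sumℤ-map-upTo n F = cong sumℤ (List.map-upTo F n)

sumBelow-suc : ∀ n (F : ℕ → ℤ) → sumBelow (suc n) F ≡ sumBelow n F +ᶻ F n
sumBelow-suc zero    F = trans (ℤ.+-identityʳ (F 0)) (sym (ℤ.+-identityˡ (F 0)))
sumBelow-suc (suc n) F = begin
  F 0 +ᶻ sumBelow (suc n) (F ∘ suc)         ≡⟨ cong (F 0 +ᶻ_) (sumBelow-suc n (F ∘ suc)) ⟩
  F 0 +ᶻ (sumBelow n (F ∘ suc) +ᶻ F (suc n)) ≡⟨ sym (ℤ.+-assoc (F 0) _ _) ⟩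
  F 0 +ᶻ sumBelow n (F ∘ suc) +ᶻ F (suc n)   ∎

⊛-as-sum : ∀ (a b : Series) n → (a ⊛ b) n ≡ sumBelow (suc n) (λ i → a i *ᶻ b (n ∸ i))
⊛-as-sum a b n = sumℤ-map-upTo (suc n) (λ i → a i *ᶻ b (n ∸ i))

⊛-zero : ∀ (a b : Series) → (a ⊛ b) 0 ≡ a 0 *ᶻ b 0
⊛-zero a b = ℤ.+-identityʳ (a 0 *ᶻ b 0)

⊛-suc : ∀ (a b : Series) n → (a ⊛ b) (suc n) ≡ a 0 *ᶻ b (suc n) +ᶻ ((a ∘ suc) ⊛ b) n
⊛-suc a b n = trans (⊛-as-sum a b (suc n)) (cong (a 0 *ᶻ b (suc n) +ᶻ_) (sym (⊛-as-sum (a ∘ suc) b n)))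

⊛-congˡ : ∀ {a a′ : Series} (b : Series) → (∀ i → a i ≡ a′ i) → ∀ n → (a ⊛ b) n ≡ (a′ ⊛ b) n
⊛-congˡ b a≗a′ n = cong sumℤ (List.map-cong (λ i → cong (_*ᶻ b (n ∸ i)) (a≗a′ i)) (upTo (suc n)))

⊛-distribʳ-+ : ∀ (a a′ b : Series) n → ((λ i → a i +ᶻ a′ i) ⊛ b) n ≡ (a ⊛ b) n +ᶻ (a′ ⊛ b) n
⊛-distribʳ-+ a a′ b zero = begin
  ((λ i → a i +ᶻ a′ i) ⊛ b) 0       ≡⟨ ⊛-zero (λ i → a i +ᶻ a′ i) b ⟩
  (a 0 +ᶻ a′ 0) *ᶻ b 0              ≡⟨ ℤ.*-distribʳ-+ (b 0) (a 0) (a′ 0) ⟩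
  a 0 *ᶻ b 0 +ᶻ a′ 0 *ᶻ b 0         ≡⟨ sym (cong₂ _+ᶻ_ (⊛-zero a b) (⊛-zero a′ b)) ⟩
  (a ⊛ b) 0 +ᶻ (a′ ⊛ b) 0           ∎
⊛-distribʳ-+ a a′ b (suc n) = begin
  ((λ i → a i +ᶻ a′ i) ⊛ b) (suc n)
    ≡⟨ ⊛-suc (λ i → a i +ᶻ a′ i) b n ⟩
  (a 0 +ᶻ a′ 0) *ᶻ b (suc n) +ᶻ ((λ i → a (suc i) +ᶻ a′ (suc i)) ⊛ b) n
    ≡⟨ cong ((a 0 +ᶻ a′ 0) *ᶻ b (suc n) +ᶻ_) (⊛-distribʳ-+ (a ∘ suc) (a′ ∘ suc) b n) ⟩
  (a 0 +ᶻ a′ 0) *ᶻ b (suc n) +ᶻ (((a ∘ suc) ⊛ b) n +ᶻ ((a′ ∘ suc) ⊛ b) n)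
    ≡⟨ regroup (a 0) (a′ 0) (b (suc n)) _ _ ⟩
  (a 0 *ᶻ b (suc n) +ᶻ ((a ∘ suc) ⊛ b) n) +ᶻ (a′ 0 *ᶻ b (suc n) +ᶻ ((a′ ∘ suc) ⊛ b) n)
    ≡⟨ sym (cong₂ _+ᶻ_ (⊛-suc a b n) (⊛-suc a′ b n)) ⟩
  (a ⊛ b) (suc n) +ᶻ (a′ ⊛ b) (suc n)
    ∎
  where
  regroup : ∀ x x′ y p p′ → (x +ᶻ x′) *ᶻ y +ᶻ (p +ᶻ p′) ≡ (x *ᶻ y +ᶻ p) +ᶻ (x′ *ᶻ y +ᶻ p′)
  regroup = solve-∀

⊛-scaleˡ : ∀ k (a b : Series) n → ((λ i → k *ᶻ a i) ⊛ b) n ≡ k *ᶻ (a ⊛ b) n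
⊛-scaleˡ k a b zero = begin
  ((λ i → k *ᶻ a i) ⊛ b) 0  ≡⟨ ⊛-zero (λ i → k *ᶻ a i) b ⟩
  k *ᶻ a 0 *ᶻ b 0            ≡⟨ ℤ.*-assoc k (a 0) (b 0) ⟩
  k *ᶻ (a 0 *ᶻ b 0)          ≡⟨ cong (k *ᶻ_) (sym (⊛-zero a b)) ⟩
  k *ᶻ (a ⊛ b) 0             ∎
⊛-scaleˡ k a b (suc n) = begin
  ((λ i → k *ᶻ a i) ⊛ b) (suc n)
    ≡⟨ ⊛-suc (λ i → k *ᶻ a i) b n ⟩
  k *ᶻ a 0 *ᶻ b (suc n) +ᶻ ((λ i → k *ᶻ a (suc i)) ⊛ b) n
    ≡⟨ cong (k *ᶻ a 0 *ᶻ b (suc n) +ᶻ_) (⊛-scaleˡ k (a ∘ suc) b n) ⟩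
  k *ᶻ a 0 *ᶻ b (suc n) +ᶻ k *ᶻ ((a ∘ suc) ⊛ b) n
    ≡⟨ regroup k (a 0) (b (suc n)) _ ⟩
  k *ᶻ (a 0 *ᶻ b (suc n) +ᶻ ((a ∘ suc) ⊛ b) n)
    ≡⟨ cong (k *ᶻ_) (sym (⊛-suc a b n)) ⟩
  k *ᶻ (a ⊛ b) (suc n)
    ∎
  where
  regroup : ∀ k x y p → k *ᶻ x *ᶻ y +ᶻ k *ᶻ p ≡ k *ᶻ (x *ᶻ y +ᶻ p)
  regroup = solve-∀

⊛-assoc : ∀ (a b c : Series) n → (a ⊛ (b ⊛ c)) n ≡ ((a ⊛ b) ⊛ c) n
⊛-assoc a b c zero = begin
  (a ⊛ (b ⊛ c)) 0      ≡⟨ ⊛-zero a (b ⊛ c) ⟩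
  a 0 *ᶻ (b ⊛ c) 0      ≡⟨ cong (a 0 *ᶻ_) (⊛-zero b c) ⟩
  a 0 *ᶻ (b 0 *ᶻ c 0)   ≡⟨ sym (ℤ.*-assoc (a 0) (b 0) (c 0)) ⟩
  a 0 *ᶻ b 0 *ᶻ c 0     ≡⟨ cong (_*ᶻ c 0) (sym (⊛-zero a b)) ⟩
  (a ⊛ b) 0 *ᶻ c 0      ≡⟨ sym (⊛-zero (a ⊛ b) c) ⟩
  ((a ⊛ b) ⊛ c) 0       ∎
⊛-assoc a b c (suc n) = begin
  (a ⊛ (b ⊛ c)) (suc n)
    ≡⟨ ⊛-suc a (b ⊛ c) n ⟩
  a 0 *ᶻ (b ⊛ c) (suc n) +ᶻ ((a ∘ suc) ⊛ (b ⊛ c)) n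
    ≡⟨ cong₂ (λ x y → a 0 *ᶻ x +ᶻ y) (⊛-suc b c n) (⊛-assoc (a ∘ suc) b c n) ⟩
  a 0 *ᶻ (b 0 *ᶻ c (suc n) +ᶻ ((b ∘ suc) ⊛ c) n) +ᶻ (((a ∘ suc) ⊛ b) ⊛ c) n
    ≡⟨ regroup (a 0) (b 0) (c (suc n)) _ _ ⟩
  a 0 *ᶻ b 0 *ᶻ c (suc n) +ᶻ (a 0 *ᶻ ((b ∘ suc) ⊛ c) n +ᶻ (((a ∘ suc) ⊛ b) ⊛ c) n)
    ≡⟨ cong₂ (λ x y → x *ᶻ c (suc n) +ᶻ y) (sym (⊛-zero a b)) (sym shifted) ⟩
  (a ⊛ b) 0 *ᶻ c (suc n) +ᶻ (((a ⊛ b) ∘ suc) ⊛ c) n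
    ≡⟨ sym (⊛-suc (a ⊛ b) c n) ⟩
  ((a ⊛ b) ⊛ c) (suc n)
    ∎
  where
  regroup : ∀ x y z p q → x *ᶻ (y *ᶻ z +ᶻ p) +ᶻ q ≡ x *ᶻ y *ᶻ z +ᶻ (x *ᶻ p +ᶻ q)
  regroup = solve-∀
  shifted : (((a ⊛ b) ∘ suc) ⊛ c) n ≡ a 0 *ᶻ ((b ∘ suc) ⊛ c) n +ᶻ (((a ∘ suc) ⊛ b) ⊛ c) n
  shifted = begin
    (((a ⊛ b) ∘ suc) ⊛ c) n
      ≡⟨ ⊛-congˡ c (⊛-suc a b) n ⟩
    ((λ i → a 0 *ᶻ b (suc i) +ᶻ ((a ∘ suc) ⊛ b) i) ⊛ c) n
      ≡⟨ ⊛-distribʳ-+ (λ i → a 0 *ᶻ b (suc i)) ((a ∘ suc) ⊛ b) c n ⟩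
    ((λ i → a 0 *ᶻ b (suc i)) ⊛ c) n +ᶻ (((a ∘ suc) ⊛ b) ⊛ c) n
      ≡⟨ cong (_+ᶻ (((a ∘ suc) ⊛ b) ⊛ c) n) (⊛-scaleˡ (a 0) (b ∘ suc) c n) ⟩
    a 0 *ᶻ ((b ∘ suc) ⊛ c) n +ᶻ (((a ∘ suc) ⊛ b) ⊛ c) n
      ∎

Odd : ℕ → Set
Odd m = ¬ 2 ℕ.∣ m

Odd-split : ∀ i j → Odd (i + j) → Odd i ⊎ Odd j
Odd-split i j odd with 2 ℕ.∣? i
... | no  2∤i = inj₁ 2∤i
... | yes 2∣i = inj₂ (λ 2∣j → odd (ℕ.∣m∣n⇒∣m+n 2∣i 2∣j))

Odd-drop-2 : ∀ m → Odd (suc (suc m)) → Odd m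
Odd-drop-2 m odd 2∣m = odd (ℕ.∣m∣n⇒∣m+n (ℕ.n∣n {2}) 2∣m)

Odd-1+2*n : ∀ n → Odd (suc (2 * n))
Odd-1+2*n n 2∣1+2n
  with ℕ.∣1⇒≡1 (ℕ.∣m+n∣m⇒∣n (subst (2 ℕ.∣_) (ℕ.+-comm 1 (2 * n)) 2∣1+2n) (ℕ.m∣m*n n))
... | ()

Even : ℤ → Set
Even x = + 2 ℤ.∣ x

Even-0 : Even (+ 0)
Even-0 = ℤ.divides (+ 0) refl

Even-double : ∀ x → Even (x +ᶻ x)
Even-double x = ℤ.divides x (double≡*2 x)
  where
  double≡*2 : ∀ x → x +ᶻ x ≡ x *ᶻ + 2
  double≡*2 = solve-∀

sumBelow-even : ∀ n (F : ℕ → ℤ) → (∀ i → i < n → Even (F i)) → Even (sumBelow n F)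
sumBelow-even zero    F even = Even-0
sumBelow-even (suc n) F even =
  ℤ.∣m∣n⇒∣m+n (even 0 (s≤s z≤n)) (sumBelow-even n (F ∘ suc) (λ i i<n → even (suc i) (s≤s i<n)))

-- Pairing the term i with the term m ∸ i leaves no fixed point since m is odd.
sumBelow-palindrome-even : ∀ m (F : ℕ → ℤ) → Odd m → (∀ i → i ≤ m → F i ≡ F (m ∸ i)) →
                           Even (sumBelow (suc m) F)
sumBelow-palindrome-even zero          F odd palin = ⊥-elim (odd (2 ℕ.∣0))
sumBelow-palindrome-even (suc zero)    F odd palin =
  subst Even (cong (F 0 +ᶻ_) (trans (sym (palin 1 (s≤s z≤n))) (sym (ℤ.+-identityʳ (F 1))))) (Even-double (F 0))
sumBelow-palindrome-even (suc (suc m)) F odd palin =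
  subst Even (sym sum≡) (ℤ.∣m∣n⇒∣m+n (Even-double (F 0)) inner-even)
  where
  inner : ℤ
  inner = sumBelow (suc m) (F ∘ suc)
  inner-even : Even inner
  inner-even = sumBelow-palindrome-even m (F ∘ suc) (Odd-drop-2 m odd)
    (λ i i≤m → trans (palin (suc i) (s≤s (ℕ.m≤n⇒m≤1+n i≤m))) (cong F (ℕ.+-∸-assoc 1 i≤m)))
  regroup : ∀ x y → x +ᶻ (y +ᶻ x) ≡ x +ᶻ x +ᶻ y
  regroup = solve-∀
  sum≡ : sumBelow (suc (suc (suc m))) F ≡ F 0 +ᶻ F 0 +ᶻ inner
  sum≡ = begin
    F 0 +ᶻ sumBelow (suc (suc m)) (F ∘ suc) ≡⟨ cong (F 0 +ᶻ_) (sumBelow-suc (suc m) (F ∘ suc)) ⟩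
    F 0 +ᶻ (inner +ᶻ F (suc (suc m)))      ≡⟨ cong (λ x → F 0 +ᶻ (inner +ᶻ x)) (sym (palin 0 z≤n)) ⟩
    F 0 +ᶻ (inner +ᶻ F 0)                  ≡⟨ regroup (F 0) inner ⟩
    F 0 +ᶻ F 0 +ᶻ inner                    ∎

OddPartEven : Series → Set
OddPartEven s = ∀ m → Odd m → Even (s m)

⊛-oddPartEven : ∀ {a b} → OddPartEven a → OddPartEven b → OddPartEven (a ⊛ b)
⊛-oddPartEven {a} {b} ea eb m odd =
  subst Even (sym (⊛-as-sum a b m)) (sumBelow-even (suc m) _ term-even)
  where
  term-even : ∀ i → i < suc m → Even (a i *ᶻ b (m ∸ i))
  term-even i (s≤s i≤m) with Odd-split i (m ∸ i) (subst Odd (sym (ℕ.m+[n∸m]≡n i≤m)) odd)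
  ... | inj₁ odd-i = ℤ.∣m⇒∣m*n (b (m ∸ i)) (ea i odd-i)
  ... | inj₂ odd-j = ℤ.∣n⇒∣m*n (a i) (eb (m ∸ i) odd-j)

one-oddPartEven : OddPartEven one
one-oddPartEven zero    odd = ⊥-elim (odd (2 ℕ.∣0))
one-oddPartEven (suc m) odd = Even-0

pow-oddPartEven : ∀ {s} → OddPartEven s → ∀ k → OddPartEven (pow s k)
pow-oddPartEven es zero    = one-oddPartEven
pow-oddPartEven es (suc k) = ⊛-oddPartEven es (pow-oddPartEven es k)

oneMinusQ^-oddPartEven : ∀ {d} → 2 ℕ.∣ d → OddPartEven (oneMinusQ^ d)
oneMinusQ^-oddPartEven {d} 2∣d m odd with m ℕ.≡ᵇ 0 in m≡ᵇ0
... | true  = ⊥-elim (odd (subst (2 ℕ.∣_) (sym (ℕ.≡ᵇ⇒≡ m 0 (subst T (sym m≡ᵇ0) tt))) (2 ℕ.∣0)))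
... | false with m ℕ.≡ᵇ d in m≡ᵇd
...   | true  = ⊥-elim (odd (subst (2 ℕ.∣_) (sym (ℕ.≡ᵇ⇒≡ m d (subst T (sym m≡ᵇd) tt))) 2∣d))
...   | false = Even-0

partialProd-oddPartEven : ∀ {ℓ} → 2 ℕ.∣ ℓ → ∀ N → OddPartEven (partialProd ℓ N)
partialProd-oddPartEven 2∣ℓ zero    = one-oddPartEven
partialProd-oddPartEven 2∣ℓ (suc N) =
  ⊛-oddPartEven (partialProd-oddPartEven 2∣ℓ N) (oneMinusQ^-oddPartEven (ℕ.∣m⇒∣m*n (suc N) 2∣ℓ))

f-oddPartEven : ∀ {ℓ} → 2 ℕ.∣ ℓ → OddPartEven (f ℓ)
f-oddPartEven 2∣ℓ m = partialProd-oddPartEven 2∣ℓ m m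

invUpTo-oddPartEven : ∀ {s} → OddPartEven s → ∀ N j → j ≤ N → Odd j → Even (invUpTo s N j)
invUpTo-oddPartEven es zero    zero j≤N odd = ⊥-elim (odd (2 ℕ.∣0))
invUpTo-oddPartEven {s} es (suc N) j j≤1+N odd with j ≤ᵇ N in j≤ᵇN
... | true  = invUpTo-oddPartEven es N j (ℕ.≤ᵇ⇒≤ j N (subst T (sym j≤ᵇN) tt)) odd
... | false = ℤ.∣m⇒∣-m (subst Even (sym (sumℤ-map-upTo (suc N) term)) (sumBelow-even (suc N) term term-even))
  where
  j≡1+N : j ≡ suc N
  j≡1+N = ℕ.≤-antisym j≤1+N (ℕ.≰⇒> (λ j≤N → subst T j≤ᵇN (ℕ.≤⇒≤ᵇ j≤N)))
  term : ℕ → ℤ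
  term i = s (suc i) *ᶻ invUpTo s N (N ∸ i)
  term-even : ∀ i → i < suc N → Even (term i)
  term-even i (s≤s i≤N)
    with Odd-split (suc i) (N ∸ i) (subst Odd (trans j≡1+N (cong suc (sym (ℕ.m+[n∸m]≡n i≤N)))) odd)
  ... | inj₁ odd-i = ℤ.∣m⇒∣m*n (invUpTo s N (N ∸ i)) (es (suc i) odd-i)
  ... | inj₂ odd-j = ℤ.∣n⇒∣m*n (s (suc i)) (invUpTo-oddPartEven es N (N ∸ i) (ℕ.m∸n≤m N i) odd-j)

inv-oddPartEven : ∀ {s} → OddPartEven s → OddPartEven (inv s)
inv-oddPartEven es m = invUpTo-oddPartEven es m m ℕ.≤-refl

square-oddPartEven : ∀ s → OddPartEven (s ⊛ s)
square-oddPartEven s m odd =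
  subst Even (sym (⊛-as-sum s s m)) (sumBelow-palindrome-even m (λ i → s i *ᶻ s (m ∸ i)) odd palin)
  where
  palin : ∀ i → i ≤ m → s i *ᶻ s (m ∸ i) ≡ s (m ∸ i) *ᶻ s (m ∸ (m ∸ i))
  palin i i≤m = trans (ℤ.*-comm (s i) (s (m ∸ i))) (cong (λ k → s (m ∸ i) *ᶻ s k) (sym (ℕ.m∸[m∸n]≡n i≤m)))

pow-2*-oddPartEven : ∀ s r → OddPartEven (pow s (2 * r))
pow-2*-oddPartEven s zero = one-oddPartEven
pow-2*-oddPartEven s (suc r) = subst (OddPartEven ∘ pow s) (sym (ℕ.*-suc 2 r)) λ m odd →
  subst Even (sym (⊛-assoc s s (pow s (2 * r)) m))
    (⊛-oddPartEven (square-oddPartEven s) (pow-2*-oddPartEven s r) m odd)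

theorem6 : ∀ (r n : ℕ) → (+ 2) ∣ a (2 * r) (suc (2 * n))
theorem6 r n = ℤ.∣⇒∣ᵤ (a-2r-oddPartEven (suc (2 * n)) (Odd-1+2*n n))
  where
  f₂-oddPartEven : OddPartEven (f 2)
  f₂-oddPartEven = f-oddPartEven (ℕ.n∣n {2})
  a-2r-oddPartEven : OddPartEven (a (2 * r))
  a-2r-oddPartEven =
    ⊛-oddPartEven (⊛-oddPartEven (pow-oddPartEven f₂-oddPartEven (2 * r)) (inv-oddPartEven f₂-oddPartEven))
                  (pow-2*-oddPartEven (inv (f 1)) r)
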